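{- Let $G$ be a graph and $S=\{B_i=B_{r_i}(s_i)\}_{i\in[n]}$ a set of $n$ pairwise vertex-disjoint balls in $G$, and let $E_S\subseteq\binom{S}{2}$ be a set of pairs $\{B_i,B_j\}$ of balls of $S$, each of which is associated with a ball $B_{\{i,j\}}\notin S$ of $G$ which intersects $B_i$ and $B_j$ and no other ball of $S$. Then the graph $H=(S,E_S)$ is a minor of $G$.
   Context: Graphs are finite. For a vertex $v$ and integer $r\ge 0$, the ball $B_r(v)=\{u\in V(G): d_G(u,v)\le r\}$, where $d_G$ is the shortest-path distance in $G$. -}

module Defs where

open import Data.Nat using (ℕ; zero; suc; _≤_)
open import Data.Fin using (Fin)
open import Data.Empty using (⊥)
open import Data.Product using (Σ; ∃; _×_; _,_)
open import Relation.Nullary using (¬_; Dec)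
open import Relation.Binary.PropositionalEquality using (_≡_; _≢_)

record Graph (N : ℕ) : Set₁ where
  field
    Adj    : Fin N → Fin N → Set
    adj?   : ∀ u v → Dec (Adj u v)
    sym    : ∀ {u v} → Adj u v → Adj v u
    irrefl : ∀ {u} → ¬ Adj u u
open Graph public

data Walk {N : ℕ} (G : Graph N) : Fin N → Fin N → ℕ → Set where
  stay : ∀ {u} → Walk G u u zero
  step : ∀ {u w v k} → Adj G u w → Walk G w v k → Walk G u v (suc k)

-- d_G(u,v) ≤ r  iff there is a walk (equivalently a path) of length ≤ r.
DistLe : ∀ {N} → Graph N → Fin N → Fin N → ℕ → Set
DistLe G u v r = Σ ℕ λ k → k ≤ r × Walk G u v k

InBall : ∀ {N} → Graph N → Fin N → ℕ → Fin N → Set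
InBall G s r u = DistLe G u s r

SameSet : ∀ {N} → (Fin N → Set) → (Fin N → Set) → Set
SameSet X Y = ∀ u → (X u → Y u) × (Y u → X u)

Intersect : ∀ {N} → (Fin N → Set) → (Fin N → Set) → Set
Intersect X Y = ∃ λ u → X u × Y u

data WalkIn {N : ℕ} (G : Graph N) (X : Fin N → Set) : Fin N → Fin N → Set where
  stayIn : ∀ {u} → X u → WalkIn G X u u
  stepIn : ∀ {u w v} → X u → Adj G u w → WalkIn G X w v → WalkIn G X u v

ConnectedIn : ∀ {N} → Graph N → (Fin N → Set) → Set
ConnectedIn G X = ∀ u v → X u → X v → WalkIn G X u v

record MinorModel {n N : ℕ} (H : Graph n) (G : Graph N) : Set₁ where
  field
    branch    : Fin n → Fin N → Set
    nonempty  : ∀ i → ∃ λ u → branch i u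
    disjoint  : ∀ i j → i ≢ j → ∀ u → branch i u → branch j u → ⊥
    connected : ∀ i → ConnectedIn G (branch i)
    edges     : ∀ i j → Adj H i j → ∃ λ u → ∃ λ v → branch i u × branch j v × Adj G u v

IsMinorOf : ∀ {n N} → Graph n → Graph N → Set₁
IsMinorOf H G = MinorModel H G

-- Assign each vertex v to the centre s i minimising d(v, s i) − r i, ties going to the
-- smallest index. These weighted Voronoi cells are pairwise disjoint; a shortest path
-- from v to s i never leaves the cell of i, so cells are connected; and s i lies in its
-- own cell because the balls of S are pairwise disjoint. If a ball B_ρ(c) meets B i and
-- B j but no other ball of S, then from c the centres i and j strictly beat every other
-- centre, and this stays true along a shortest path from c to s j. Hence every vertex of
-- that path lies in the cell of i or of j; as c can be taken in the cell of i and s j is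
-- in the cell of j, some edge of the path joins the two cells.
module Submission where

open import Defs
open import Level using (0ℓ)
open import Data.Nat using (ℕ; zero; suc; _+_; _≤_; _<_; _≤?_; z≤n; s≤s; s≤s⁻¹; s<s⁻¹)
open import Data.Nat.Properties hiding (_≟_)
open import Data.Nat.Solver using (module +-*-Solver)
open import Data.Fin using (Fin) renaming (_≤_ to _≤ᶠ_)
open import Data.Fin.Properties as Fin using (any?; _≟_)
open import Data.Product using (Σ; ∃₂; _×_; _,_; proj₁; proj₂)
open import Data.Product.Relation.Binary.Lex.Strict using (×-Lex; ×-transitive; ×-total₂; ×-antisymmetric)
open import Data.Sum using (_⊎_; inj₁; inj₂)
open import Data.Empty using (⊥; ⊥-elim)
open import Relation.Nullary using (¬_; Dec; yes; no)
open import Relation.Nullary.Decidable using (map′; _×-dec_)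
open import Relation.Unary using (Decidable)
open import Relation.Binary using (Rel)
open import Relation.Binary.PropositionalEquality
  using (_≡_; _≢_; refl; cong; isEquivalence; ≢-sym) renaming (sym to ≡-sym)

least-witness : ∀ {P : ℕ → Set} → Decidable P → ∀ {m} → P m →
  Σ ℕ λ b → P b × (∀ {a} → P a → b ≤ a)
least-witness P? {m} pm with P? 0
... | yes p0 = 0 , p0 , λ _ → z≤n
least-witness P? {zero} pm | no ¬p0 = ⊥-elim (¬p0 pm)
least-witness P? {suc m} pm | no ¬p0 with least-witness (λ k → P? (suc k)) pm
... | b , pb , least = suc b , pb , λ { {zero} p0 → ⊥-elim (¬p0 p0) ; {suc a} pa → s≤s (least pa) }

-- a − d ≤ b − e < c − f  implies  a − d < c − f, stated without subtraction.
a+e≤b+d⇒b+f<c+e⇒a+f<c+d : ∀ a b c d e f → a + e ≤ b + d → b + f < c + e → a + f < c + d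
a+e≤b+d⇒b+f<c+e⇒a+f<c+d a b c d e f a+e≤b+d b+f<c+e =
  +-cancelʳ-< (b + e) (a + f) (c + d) (shuffle (+-mono-≤-< a+e≤b+d b+f<c+e))
  where
  open +-*-Solver
  shuffle : (a + e) + (b + f) < (b + d) + (c + e) → (a + f) + (b + e) < (c + d) + (b + e)
  shuffle lt
    rewrite solve 4 (λ a e b f → (a :+ e) :+ (b :+ f) := (a :+ f) :+ (b :+ e)) refl a e b f
          | solve 4 (λ b d c e → (b :+ d) :+ (c :+ e) := (c :+ d) :+ (b :+ e)) refl b d c e
          = lt

m≤n+o⇒n+p<q⇒m+p<q+o : ∀ m n o p q → m ≤ n + o → n + p < q → m + p < q + o
m≤n+o⇒n+p<q⇒m+p<q+o m n o p q m≤n+o n+p<q = begin-strict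
  m + p       ≤⟨ +-monoˡ-≤ p m≤n+o ⟩
  n + o + p   ≡⟨ +-assoc n o p ⟩
  n + (o + p) ≡⟨ cong (n +_) (+-comm o p) ⟩
  n + (p + o) ≡⟨ +-assoc n p o ⟨
  n + p + o   <⟨ +-monoˡ-< o n+p<q ⟩
  q + o       ∎
  where open ≤-Reasoning

module _ {N : ℕ} (G : Graph N) where

  walk-∷ʳ : ∀ {u w v k} → Walk G u w k → Adj G w v → Walk G u v (suc k)
  walk-∷ʳ stay       e = step e stay
  walk-∷ʳ (step a p) e = step a (walk-∷ʳ p e)

  walk-reverse : ∀ {u v k} → Walk G u v k → Walk G v u k
  walk-reverse stay       = stay
  walk-reverse (step a p) = walk-∷ʳ (walk-reverse p) (sym G a)

  walk-++ : ∀ {u w v k l} → Walk G u w k → Walk G w v l → Walk G u v (k + l)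
  walk-++ stay       q = q
  walk-++ (step a p) q = step a (walk-++ p q)

  walk-split : ∀ {u v k} x y → Walk G u v k → k ≤ x + y →
    Σ (Fin N) λ w → DistLe G u w x × DistLe G w v y
  walk-split {u} zero    y p          k≤y = u , (0 , z≤n , stay) , (_ , k≤y , p)
  walk-split {u} (suc x) y stay       _   = u , (0 , z≤n , stay) , (0 , z≤n , stay)
  walk-split     (suc x) y (step a p) (s≤s k≤x+y) with walk-split x y p k≤x+y
  ... | w , (l , l≤x , q) , w⇝v = w , (suc l , s≤s l≤x , step a q) , w⇝v

  distLe-reverse : ∀ {u v x} → DistLe G u v x → DistLe G v u x
  distLe-reverse (k , k≤x , p) = k , k≤x , walk-reverse p

  distLe-trans : ∀ {u w v x y} → DistLe G u w x → DistLe G w v y → DistLe G u v (x + y)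
  distLe-trans (k , k≤x , p) (l , l≤y , q) = k + l , +-mono-≤ k≤x l≤y , walk-++ p q

  walkIn-∷ʳ : ∀ {X u w v} → WalkIn G X u w → Adj G w v → X v → WalkIn G X u v
  walkIn-∷ʳ (stayIn xu)     e xv = stepIn xu e (stayIn xv)
  walkIn-∷ʳ (stepIn xu a p) e xv = stepIn xu a (walkIn-∷ʳ p e xv)

  walkIn-reverse : ∀ {X u v} → WalkIn G X u v → WalkIn G X v u
  walkIn-reverse (stayIn xu)     = stayIn xu
  walkIn-reverse (stepIn xu a p) = walkIn-∷ʳ (walkIn-reverse p) (sym G a) xu

  walkIn-++ : ∀ {X u w v} → WalkIn G X u w → WalkIn G X w v → WalkIn G X u v
  walkIn-++ (stayIn _)      q = q
  walkIn-++ (stepIn xu a p) q = stepIn xu a (walkIn-++ p q)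

  walk? : ∀ k u v → Dec (Walk G u v k)
  walk? zero u v with u ≟ v
  ... | yes refl = yes stay
  ... | no u≢v   = no λ { stay → u≢v refl }
  walk? (suc k) u v =
    map′ (λ (_ , a , p) → step a p) (λ { (step a p) → _ , a , p })
         (any? λ w → adj? G u w ×-dec walk? k w v)

  DistGe : Fin N → Fin N → ℕ → Set
  DistGe u v m = ∀ {a} → Walk G u v a → m ≤ a

  IsDistance : Fin N → Fin N → ℕ → Set
  IsDistance u v d = Walk G u v d × DistGe u v d

  shortest-walk : ∀ {u v m} → Walk G u v m → Σ ℕ λ d → IsDistance u v d × d ≤ m
  shortest-walk {u} {v} p with least-witness (λ k → walk? k u v) p
  ... | d , q , least = d , (q , least) , least p

  distGe-step : ∀ {u w v m} → Adj G u w → DistGe u v (suc m) → DistGe w v m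
  distGe-step a u⇝v≥ p = s≤s⁻¹ (u⇝v≥ (step a p))

  disjoint-balls⇒far : ∀ {u v ρ σ a} → ¬ Intersect (InBall G u ρ) (InBall G v σ) →
    Walk G u v a → ρ + σ < a
  disjoint-balls⇒far {ρ = ρ} {σ} {a} disjoint p with a ≤? ρ + σ
  ... | no  a≰ρ+σ = ≰⇒> a≰ρ+σ
  ... | yes a≤ρ+σ with walk-split ρ σ p a≤ρ+σ
  ...   | w , u⇝w , w⇝v = ⊥-elim (disjoint (w , distLe-reverse u⇝w , w⇝v))

  intersecting-balls⇒distance : ∀ {u v ρ σ} → Intersect (InBall G u ρ) (InBall G v σ) →
    Σ ℕ λ d → IsDistance u v d × d ≤ ρ + σ
  intersecting-balls⇒distance (w , w⇝u , w⇝v) with distLe-trans (distLe-reverse w⇝u) w⇝v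
  ... | _ , m≤ρ+σ , p with shortest-walk p
  ...   | d , dist , d≤m = d , dist , ≤-trans d≤m m≤ρ+σ

infix 4 _⊑_
_⊑_ : ∀ {n} → Rel (ℕ × Fin n) 0ℓ
_⊑_ = ×-Lex _≡_ _<_ _≤ᶠ_

module _ {n : ℕ} where

  ⊑-trans : ∀ {p q t : ℕ × Fin n} → p ⊑ q → q ⊑ t → p ⊑ t
  ⊑-trans = ×-transitive {_≈₁_ = _≡_} {_<₁_ = _<_} {_<₂_ = _≤ᶠ_} isEquivalence <-resp₂-≡ <-trans Fin.≤-trans

  ⊑-total : ∀ (p q : ℕ × Fin n) → p ⊑ q ⊎ q ⊑ p
  ⊑-total = ×-total₂ {_≈₁_ = _≡_} {_<₁_ = _<_} {_<₂_ = _≤ᶠ_} ≡-sym <-cmp Fin.≤-total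

  ⊑-antisym-index : ∀ {x y} {i j : Fin n} → (x , i) ⊑ (y , j) → (y , j) ⊑ (x , i) → i ≡ j
  ⊑-antisym-index p q = proj₂ (×-antisymmetric {_≈₁_ = _≡_} {_<₁_ = _<_} {_≈₂_ = _≡_} {_<₂_ = _≤ᶠ_} ≡-sym <-irrefl <-asym Fin.≤-antisym p q)

  <⇒⊑ : ∀ {x y} {i k : Fin n} → x < y → (x , i) ⊑ (y , k)
  <⇒⊑ = inj₁

  ≤⇒⊑ : ∀ {x y} {i : Fin n} → x ≤ y → (x , i) ⊑ (y , i)
  ≤⇒⊑ x≤y with m≤n⇒m<n∨m≡n x≤y
  ... | inj₁ x<y = inj₁ x<y
  ... | inj₂ x≡y = inj₂ (x≡y , Fin.≤-refl)

  ⊑⇒≤ : ∀ {x y} {i k : Fin n} → (x , i) ⊑ (y , k) → x ≤ y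
  ⊑⇒≤ (inj₁ x<y)       = <⇒≤ x<y
  ⊑⇒≤ (inj₂ (refl , _)) = ≤-refl

  ⊑-suc⁻¹ : ∀ {x y} {i k : Fin n} → (suc x , i) ⊑ (suc y , k) → (x , i) ⊑ (y , k)
  ⊑-suc⁻¹ (inj₁ x<y)         = inj₁ (s<s⁻¹ x<y)
  ⊑-suc⁻¹ (inj₂ (refl , i≤k)) = inj₂ (refl , i≤k)

module WeightedVoronoi {N n : ℕ} (G : Graph N) (s : Fin n → Fin N) (r : Fin n → ℕ) where

  -- Beats i v b encodes  b − r i ≤ d(v, s k) − r k  for every k, with the smaller index
  -- winning ties; the case k = i says that b is the distance from v to s i.
  Beats : Fin n → Fin N → ℕ → Set
  Beats i v b = ∀ k {a} → Walk G v (s k) a → (b + r k , i) ⊑ (a + r i , k)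

  Cell : Fin n → Fin N → Set
  Cell i v = Σ ℕ λ b → Walk G v (s i) b × Beats i v b

  AdjacentCells : Fin n → Fin n → Set
  AdjacentCells i j = ∃₂ λ x y → Cell i x × Cell j y × Adj G x y

  adjacentCells-sym : ∀ {i j} → AdjacentCells i j → AdjacentCells j i
  adjacentCells-sym (x , y , x∈i , y∈j , xy) = y , x , y∈j , x∈i , sym G xy

  OnlyRival : Fin n → Fin n → Fin N → ℕ → Set
  OnlyRival i j v e = ∀ k → k ≢ i → k ≢ j → ∀ {a} → Walk G v (s k) a → e + r k < a + r j

  cell-disjoint : ∀ {i j v} → i ≢ j → Cell i v → Cell j v → ⊥
  cell-disjoint {i} {j} i≢j (_ , v⇝sᵢ , i-beats) (_ , v⇝sⱼ , j-beats) =
    i≢j (⊑-antisym-index (i-beats j v⇝sⱼ) (j-beats i v⇝sᵢ))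

  beats-step : ∀ {i v w b} → Adj G v w → Beats i v (suc b) → Beats i w b
  beats-step a beats k p = ⊑-suc⁻¹ (beats k (step a p))

  walkIn-cell : ∀ {i v b} → Walk G v (s i) b → Beats i v b → WalkIn G (Cell i) v (s i)
  walkIn-cell stay       beats = stayIn (0 , stay , beats)
  walkIn-cell (step a p) beats = stepIn (_ , step a p , beats) a (walkIn-cell p (beats-step a beats))

  cell-connected : ∀ i → ConnectedIn G (Cell i)
  cell-connected i u v (_ , u⇝sᵢ , u-beats) (_ , v⇝sᵢ , v-beats) =
    walkIn-++ G (walkIn-cell u⇝sᵢ u-beats) (walkIn-reverse G (walkIn-cell v⇝sᵢ v-beats))

  onlyRival-step : ∀ {i j v w e} → Adj G v w → OnlyRival i j v (suc e) → OnlyRival i j w e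
  onlyRival-step a rival k k≢i k≢j p = s<s⁻¹ (rival k k≢i k≢j (step a p))

  cell-of-winner : ∀ {i j v d e} → IsDistance G v (s i) d → DistGe G v (s j) e →
    (d + r j , i) ⊑ (e + r i , j) → OnlyRival j i v d → Cell i v
  cell-of-winner {i} {j} {d = d} (v⇝sᵢ , sᵢ-far) sⱼ-far i⊑j rival = d , v⇝sᵢ , beats
    where
    beats : Beats i _ d
    beats k p with k ≟ i | k ≟ j
    ... | yes refl | _        = ≤⇒⊑ (+-monoˡ-≤ (r i) (sᵢ-far p))
    ... | no _     | yes refl = ⊑-trans i⊑j (≤⇒⊑ (+-monoˡ-≤ (r i) (sⱼ-far p)))
    ... | no k≢i   | no k≢j   = <⇒⊑ (rival k k≢j k≢i p)

  cell-choice : ∀ {i j v d e} → IsDistance G v (s i) d → IsDistance G v (s j) e →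
    OnlyRival i j v e → Cell i v ⊎ Cell j v
  cell-choice {i} {j} {d = d} {e} sᵢ-dist sⱼ-dist rival with ⊑-total (d + r j , i) (e + r i , j)
  ... | inj₁ i⊑j = inj₁ (cell-of-winner sᵢ-dist (proj₂ sⱼ-dist) i⊑j i-rival)
    where
    i-rival : OnlyRival j i _ d
    i-rival k k≢j k≢i {a} p =
      a+e≤b+d⇒b+f<c+e⇒a+f<c+d d e a (r i) (r j) (r k) (⊑⇒≤ i⊑j) (rival k k≢i k≢j p)
  ... | inj₂ j⊑i = inj₂ (cell-of-winner sⱼ-dist (proj₂ sᵢ-dist) j⊑i rival)

  onlyRival-of-ball : ∀ {i j c ρ d} →
    (∀ k → k ≢ i → k ≢ j → ¬ Intersect (InBall G c ρ) (InBall G (s k) (r k))) →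
    d ≤ ρ + r j → OnlyRival i j c d
  onlyRival-of-ball {j = j} {ρ = ρ} {d} misses d≤ρ+rⱼ k k≢i k≢j {a} p =
    m≤n+o⇒n+p<q⇒m+p<q+o d ρ (r j) (r k) a d≤ρ+rⱼ (disjoint-balls⇒far G (misses k k≢i k≢j) p)

  module _ (disjoint : ∀ i j → i ≢ j → ¬ Intersect (InBall G (s i) (r i)) (InBall G (s j) (r j))) where

    centre-in-cell : ∀ i → Cell i (s i)
    centre-in-cell i = 0 , stay , beats
      where
      beats : Beats i (s i) 0
      beats k {a} p with k ≟ i
      ... | yes refl = ≤⇒⊑ (m≤n+m (r k) a)
      ... | no k≢i   = <⇒⊑ (begin-strict
        r k       ≤⟨ m≤n+m (r k) (r i) ⟩
        r i + r k <⟨ disjoint-balls⇒far G (disjoint i k (≢-sym k≢i)) p ⟩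
        a         ≤⟨ m≤m+n a (r i) ⟩
        a + r i   ∎)
        where open ≤-Reasoning

    crossing-edge : ∀ {i j u e} → i ≢ j → IsDistance G u (s j) e → OnlyRival i j u e → Cell i u →
      AdjacentCells i j
    crossing-edge {j = j} i≢j (stay , _) _ u∈i = ⊥-elim (cell-disjoint i≢j u∈i (centre-in-cell j))
    crossing-edge {i} {j} i≢j (step {w = w} a w⇝sⱼ , sⱼ-far) rival u∈i@(_ , u⇝sᵢ , _) =
      continue (cell-choice (proj₁ (proj₂ (shortest-walk G (step (sym G a) u⇝sᵢ)))) w-dist w-rival)
      where
      w-dist : IsDistance G w (s j) _
      w-dist = w⇝sⱼ , distGe-step G a sⱼ-far
      w-rival : OnlyRival i j w _
      w-rival = onlyRival-step a rival
      continue : Cell i w ⊎ Cell j w → AdjacentCells i j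
      continue (inj₁ w∈i) = crossing-edge i≢j w-dist w-rival w∈i
      continue (inj₂ w∈j) = _ , _ , u∈i , w∈j , a

    edge-from-ball : ∀ {i j c ρ} → i ≢ j →
      Intersect (InBall G c ρ) (InBall G (s i) (r i)) →
      Intersect (InBall G c ρ) (InBall G (s j) (r j)) →
      (∀ k → k ≢ i → k ≢ j → ¬ Intersect (InBall G c ρ) (InBall G (s k) (r k))) →
      AdjacentCells i j
    edge-from-ball {i} {j} {c} i≢j meets-i meets-j misses-others
      with intersecting-balls⇒distance G meets-i | intersecting-balls⇒distance G meets-j
    ... | dᵢ , sᵢ-dist , dᵢ≤ | dⱼ , sⱼ-dist , dⱼ≤ = from-choice (cell-choice sᵢ-dist sⱼ-dist j-rival)
      where
      j-rival : OnlyRival i j c dⱼ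
      j-rival = onlyRival-of-ball misses-others dⱼ≤
      i-rival : OnlyRival j i c dᵢ
      i-rival = onlyRival-of-ball (λ k k≢j k≢i → misses-others k k≢i k≢j) dᵢ≤
      from-choice : Cell i c ⊎ Cell j c → AdjacentCells i j
      from-choice (inj₁ c∈i) = crossing-edge i≢j sⱼ-dist j-rival c∈i
      from-choice (inj₂ c∈j) = adjacentCells-sym (crossing-edge (≢-sym i≢j) sᵢ-dist i-rival c∈j)

lemma2p2 : ∀ {N n} (G : Graph N) (s : Fin n → Fin N) (r : Fin n → ℕ) (H : Graph n)
    → (∀ i j → i ≢ j → ¬ Intersect (InBall G (s i) (r i)) (InBall G (s j) (r j)))
    → (∀ i j → Adj H i j →
         Σ (Fin N) λ c → Σ ℕ λ ρ →
           (∀ k → ¬ SameSet (InBall G c ρ) (InBall G (s k) (r k)))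
           × Intersect (InBall G c ρ) (InBall G (s i) (r i))
           × Intersect (InBall G c ρ) (InBall G (s j) (r j))
           × (∀ k → k ≢ i → k ≢ j → ¬ Intersect (InBall G c ρ) (InBall G (s k) (r k))))
    → IsMinorOf H G
lemma2p2 G s r H disjoint ball-of-edge = record
  { branch    = Cell
  ; nonempty  = λ i → s i , centre-in-cell disjoint i
  ; disjoint  = λ _ _ i≢j _ → cell-disjoint i≢j
  ; connected = cell-connected
  ; edges     = edge
  }
  where
  open WeightedVoronoi G s r
  edge : ∀ i j → Adj H i j → AdjacentCells i j
  edge i j ij with ball-of-edge i j ij
  ... | _ , _ , _ , meets-i , meets-j , misses-others =
    edge-from-ball disjoint (λ { refl → irrefl H ij }) meets-i meets-j misses-others
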